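{- Let $q$ be a prime power and $u^*=q^3+q^2$. For non-negative integers $a,u$ let \[\Psi_a(u)=\{(i,j)\in\mathbb{Z}^2: 0\le i<q^2+q,\ 0\le qi+(q^2+q)j<q^2+q,\ q^2i+(q^3-q)j\le u-(q^3+q^2)a\}.\] Then for every integer $u\ge u^*$, \[\sum_{a=0}^{\infty}\#\Psi_a(u)=\frac{ -q^2+q+2}{2}+\left\lfloor\frac{u}{q}\right\rfloor.\]
   Context: $q$ is a power of a prime; $\lfloor x\rfloor$ is the greatest integer $\le x$. -}

module Defs where

open import Data.Nat as ℕ using (ℕ; suc; _^_)
open import Data.Nat.Primality using (Prime)
open import Data.Integer as ℤ using (ℤ; +_; _-_; _≤?_; _<?_)
open import Data.Product using (Σ; ∃; _×_; _,_)
open import Data.List using (List; map; upTo; filter; length; cartesianProduct)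
open import Data.Nat.ListAction using (sum)
open import Relation.Binary.PropositionalEquality using (_≡_)
open import Relation.Nullary.Decidable using (_×-dec_; Dec)

IsPrimePower : ℕ → Set
IsPrimePower q = ∃ λ p → ∃ λ k → Prime p × (1 ℕ.≤ k) × q ≡ p ^ k


window : ℕ → List ℤ
window M = map (λ n → (+ n) - (+ M)) (upTo (suc (2 ℕ.* M)))

InΨ : ℕ → ℕ → ℕ → ℤ × ℤ → Set
InΨ q a u (i , j) =
  ((+ 0) ℤ.≤ i) × (i ℤ.< + (q ^ 2 ℕ.+ q)) ×
  ((+ 0) ℤ.≤ ((+ q) ℤ.* i ℤ.+ (+ (q ^ 2 ℕ.+ q)) ℤ.* j)) ×
  (((+ q) ℤ.* i ℤ.+ (+ (q ^ 2 ℕ.+ q)) ℤ.* j) ℤ.< + (q ^ 2 ℕ.+ q)) ×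
  (((+ (q ^ 2)) ℤ.* i ℤ.+ ((+ (q ^ 3)) - (+ q)) ℤ.* j)
     ℤ.≤ ((+ u) - (+ (q ^ 3 ℕ.+ q ^ 2)) ℤ.* (+ a)))

InΨ? : ∀ q a u p → Dec (InΨ q a u p)
InΨ? q a u (i , j) =
  ((+ 0) ≤? i) ×-dec (i <? _) ×-dec (_ ≤? _) ×-dec (_ <? _) ×-dec (_ ≤? _)

-- #Ψ_a(u): count of integer pairs in Ψ_a(u).  All elements of Ψ_a(u) lie in
-- the box [-(q²+q), q²+q]² (since 0 ≤ i < q²+q forces -q < j ≤ 0), so
-- counting inside that box counts the whole set.
#Ψ : ℕ → ℕ → ℕ → ℕ
#Ψ q a u = length (filter (InΨ? q a u)
                     (cartesianProduct (window (q ^ 2 ℕ.+ q)) (window (q ^ 2 ℕ.+ q))))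

ΣΨ : ℕ → ℕ → ℕ → ℕ
ΣΨ q u N = sum (map (λ a → #Ψ q a u) (upTo (suc N)))

module Submission where

open import Defs
open import Data.Nat as ℕ using (ℕ; _^_; _≥_; NonZero)
open import Data.Nat.DivMod using (_/_)
open import Data.Integer as ℤ using (ℤ; +_; _-_)
open import Relation.Binary.PropositionalEquality using (_≡_)

-- Put Q = q + 1, so that q² + q = qQ, and m = ⌊u/q⌋.  Every 0 ≤ i < qQ is
-- uniquely i = Qk + r with k < q, r < Q.  For such i the strip condition
-- 0 ≤ qi + qQj < qQ reads 0 ≤ r + Q(k + j) < Q, which forces j = -k; in that
-- column the last defining inequality of Ψ_a(u) becomes q(Qa + r) + Qk ≤ m.
-- Hence #Ψ_a(u) = #{(k, r) : q(Qa + r) + Qk ≤ m}.  Summing over a ≤ N and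
-- merging (a, r) into y = Qa + r, the total is  Σ_{k<q} #{y : qy + Qk ≤ m}.
-- Writing m = qs + c with c < q, the k-th count is  s - k + [k ≤ c]  (a
-- comparison of two-digit base-q numerals), and summing over k gives
-- qs - q(q-1)/2 + c + 1 = (2 + q - q²)/2 + m.  The hypothesis u ≥ q³ + q²
-- guarantees s ≥ q, and N ≥ u makes the truncated sum over a exhaust Ψ.

open import Data.Nat
open import Data.Nat.Properties
import Data.Nat.Tactic.RingSolver as ℕ-Solver
open import Data.Nat.DivMod using (_%_; m≡m%n+[m/n]*n; m%n<n; m/n≤m; m*n/n≡m; /-monoˡ-≤; m/n*n≤m)
open import Data.Integer using (-_; 0ℤ; 1ℤ; -[1+_]; +<+; +≤+)
import Data.Integer.Properties as ℤ
import Data.Integer.Tactic.RingSolver as ℤ-Solver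
open import Data.List using (List; []; _∷_; map; upTo; applyUpTo; filter; length; cartesianProduct; _++_)
open import Data.List.Properties using (map-++; map-∘; map-upTo)
open import Data.Nat.ListAction using (sum)
open import Data.Nat.ListAction.Properties using (sum-++)
open import Data.Product using (_×_; _,_; proj₂)
open import Data.Empty using (⊥-elim)
open import Function using (_∘_; _⇔_; Equivalence; mk⇔)
open import Function.Properties.Equivalence using (⇔-setoid)
open import Level using (0ℓ)
open import Relation.Nullary using (Dec; yes; no; ¬_)
open import Relation.Unary using (Pred; Decidable)
open import Relation.Binary.PropositionalEquality
  using (refl; sym; trans; cong; cong₂; subst; subst₂; _≢_; module ≡-Reasoning)
import Relation.Binary.Reasoning.Setoid

module ⇔-Reasoning = Relation.Binary.Reasoning.Setoid (⇔-setoid 0ℓ)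

𝟙 : ∀ {p} {P : Set p} → Dec P → ℕ
𝟙 (yes _) = 1
𝟙 (no _)  = 0

𝟙-cong : ∀ {p q} {P : Set p} {Q : Set q} → P ⇔ Q → (P? : Dec P) (Q? : Dec Q) → 𝟙 P? ≡ 𝟙 Q?
𝟙-cong P⇔Q (yes _) (yes _) = refl
𝟙-cong P⇔Q (yes p) (no ¬q) = ⊥-elim (¬q (Equivalence.to P⇔Q p))
𝟙-cong P⇔Q (no ¬p) (yes q) = ⊥-elim (¬p (Equivalence.from P⇔Q q))
𝟙-cong P⇔Q (no _)  (no _)  = refl

𝟙-no : ∀ {p} {P : Set p} → ¬ P → (P? : Dec P) → 𝟙 P? ≡ 0
𝟙-no ¬p (yes p) = ⊥-elim (¬p p)
𝟙-no ¬p (no _)  = refl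

length-filter-𝟙 : ∀ {a p} {A : Set a} {P : Pred A p} (P? : Decidable P) (xs : List A) →
                  length (filter P? xs) ≡ sum (map (𝟙 ∘ P?) xs)
length-filter-𝟙 P? []       = refl
length-filter-𝟙 P? (x ∷ xs) with P? x
... | yes _ = cong suc (length-filter-𝟙 P? xs)
... | no _  = length-filter-𝟙 P? xs

sum-map-zero : ∀ {a} {A : Set a} (f : A → ℕ) xs → (∀ x → f x ≡ 0) → sum (map f xs) ≡ 0
sum-map-zero f []       _   = refl
sum-map-zero f (x ∷ xs) f≡0 = cong₂ _+_ (f≡0 x) (sum-map-zero f xs f≡0)

sum-cartesianProduct : ∀ {a b} {A : Set a} {B : Set b} (h : A × B → ℕ) xs ys →
  sum (map h (cartesianProduct xs ys)) ≡ sum (map (λ x → sum (map (λ y → h (x , y)) ys)) xs)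
sum-cartesianProduct h []       ys = refl
sum-cartesianProduct h (x ∷ xs) ys = begin
  sum (map h (map (x ,_) ys ++ cartesianProduct xs ys))
    ≡⟨ cong sum (map-++ h (map (x ,_) ys) (cartesianProduct xs ys)) ⟩
  sum (map h (map (x ,_) ys) ++ map h (cartesianProduct xs ys))
    ≡⟨ sum-++ (map h (map (x ,_) ys)) _ ⟩
  sum (map h (map (x ,_) ys)) + sum (map h (cartesianProduct xs ys))
    ≡⟨ cong₂ _+_ (cong sum (sym (map-∘ ys))) (sum-cartesianProduct h xs ys) ⟩
  sum (map (λ y → h (x , y)) ys) + sum (map (λ x → sum (map (λ y → h (x , y)) ys)) xs) ∎
  where open ≡-Reasoning

Σ< : ℕ → (ℕ → ℕ) → ℕ
Σ< n f = sum (applyUpTo f n)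

Σ<-cong : ∀ n {f g : ℕ → ℕ} → (∀ i → i < n → f i ≡ g i) → Σ< n f ≡ Σ< n g
Σ<-cong zero    f≡g = refl
Σ<-cong (suc n) f≡g = cong₂ _+_ (f≡g 0 z<s) (Σ<-cong n (λ i i<n → f≡g (suc i) (s<s i<n)))

Σ<-const : ∀ n c → Σ< n (λ _ → c) ≡ n * c
Σ<-const zero    c = refl
Σ<-const (suc n) c = cong (_+_ c) (Σ<-const n c)

Σ<-zero : ∀ n {f : ℕ → ℕ} → (∀ i → i < n → f i ≡ 0) → Σ< n f ≡ 0
Σ<-zero n f≡0 = trans (Σ<-cong n f≡0) (trans (Σ<-const n 0) (*-zeroʳ n))

Σ<-+ : ∀ n f g → Σ< n (λ i → f i + g i) ≡ Σ< n f + Σ< n g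
Σ<-+ zero    f g = refl
Σ<-+ (suc n) f g = begin
  (f 0 + g 0) + Σ< n (λ i → f (suc i) + g (suc i))
    ≡⟨ cong (_+_ (f 0 + g 0)) (Σ<-+ n (f ∘ suc) (g ∘ suc)) ⟩
  (f 0 + g 0) + (Σ< n (f ∘ suc) + Σ< n (g ∘ suc))
    ≡⟨ interchange (f 0) (g 0) (Σ< n (f ∘ suc)) (Σ< n (g ∘ suc)) ⟩
  (f 0 + Σ< n (f ∘ suc)) + (g 0 + Σ< n (g ∘ suc)) ∎
  where
  open ≡-Reasoning
  interchange : ∀ a b c d → (a + b) + (c + d) ≡ (a + c) + (b + d)
  interchange = ℕ-Solver.solve-∀

Σ<-split : ∀ m n f → Σ< (m + n) f ≡ Σ< m f + Σ< n (λ i → f (m + i))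
Σ<-split zero    n f = refl
Σ<-split (suc m) n f = trans (cong (_+_ (f 0)) (Σ<-split m n (f ∘ suc))) (sym (+-assoc (f 0) _ _))

Σ<-last : ∀ n f → Σ< (suc n) f ≡ Σ< n f + f n
Σ<-last n f = begin
  Σ< (suc n) f               ≡⟨ cong (λ x → Σ< x f) (+-comm 1 n) ⟩
  Σ< (n + 1) f               ≡⟨ Σ<-split n 1 f ⟩
  Σ< n f + (f (n + 0) + 0)   ≡⟨ cong (_+_ (Σ< n f)) (trans (+-identityʳ _) (cong f (+-identityʳ n))) ⟩
  Σ< n f + f n               ∎
  where open ≡-Reasoning

Σ<-* : ∀ a b f → Σ< (a * b) f ≡ Σ< a (λ i → Σ< b (λ j → f (b * i + j)))
Σ<-* zero    b f = refl
Σ<-* (suc a) b f = begin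
  Σ< (b + a * b) f
    ≡⟨ Σ<-split b (a * b) f ⟩
  Σ< b f + Σ< (a * b) (λ i → f (b + i))
    ≡⟨ cong₂ _+_ (Σ<-cong b (λ j _ → cong (λ x → f (x + j)) (sym (*-zeroʳ b))))
                 (Σ<-* a b (λ i → f (b + i))) ⟩
  Σ< b (λ j → f (b * 0 + j)) + Σ< a (λ i → Σ< b (λ j → f (b + (b * i + j))))
    ≡⟨ cong (_+_ (Σ< b (λ j → f (b * 0 + j))))
            (Σ<-cong a (λ i _ → Σ<-cong b (λ j _ → cong f (shift i j)))) ⟩
  Σ< b (λ j → f (b * 0 + j)) + Σ< a (λ i → Σ< b (λ j → f (b * suc i + j))) ∎
  where
  open ≡-Reasoning
  shift : ∀ i j → b + (b * i + j) ≡ b * suc i + j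
  shift i j = trans (sym (+-assoc b (b * i) j)) (cong (_+ j) (sym (*-suc b i)))

Σ<-swap : ∀ m n (f : ℕ → ℕ → ℕ) → Σ< m (λ a → Σ< n (f a)) ≡ Σ< n (λ k → Σ< m (λ a → f a k))
Σ<-swap zero    n f = sym (Σ<-zero n (λ _ _ → refl))
Σ<-swap (suc m) n f = begin
  Σ< n (f 0) + Σ< m (λ a → Σ< n (f (suc a)))
    ≡⟨ cong (_+_ (Σ< n (f 0))) (Σ<-swap m n (f ∘ suc)) ⟩
  Σ< n (f 0) + Σ< n (λ k → Σ< m (λ a → f (suc a) k))
    ≡⟨ Σ<-+ n (f 0) _ ⟨
  Σ< n (λ k → f 0 k + Σ< m (λ a → f (suc a) k)) ∎
  where open ≡-Reasoning

Σ<-single : ∀ n c f → c < n → (∀ i → i < n → i ≢ c → f i ≡ 0) → Σ< n f ≡ f c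
Σ<-single (suc n) zero    f _ others =
  trans (cong (_+_ (f 0)) (Σ<-zero n (λ i i<n → others (suc i) (s<s i<n) (λ ())))) (+-identityʳ (f 0))
Σ<-single (suc n) (suc c) f (s<s c<n) others =
  trans (cong (_+ Σ< n (f ∘ suc)) (others 0 z<s (λ ())))
        (Σ<-single n c (f ∘ suc) c<n
           (λ i i<n i≢c → others (suc i) (s<s i<n) (i≢c ∘ suc-injective)))

Σ<-below : ∀ n d → d ≤ n → Σ< n (λ y → 𝟙 (y <? d)) ≡ d
Σ<-below n       zero    _         = Σ<-zero n (λ i _ → 𝟙-no (λ ()) (i <? 0))
Σ<-below (suc n) (suc d) (s≤s d≤n) =
  cong suc (trans (Σ<-cong n (λ i _ → 𝟙-cong (mk⇔ s<s⁻¹ s<s) (suc i <? suc d) (i <? d)))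
                  (Σ<-below n d d≤n))

Σ<-id : ∀ n → 2 * Σ< n (λ k → k) + n ≡ n * n
Σ<-id zero    = refl
Σ<-id (suc n) = begin
  2 * Σ< (suc n) (λ k → k) + suc n          ≡⟨ cong (λ x → 2 * x + suc n) (Σ<-last n (λ k → k)) ⟩
  2 * (Σ< n (λ k → k) + n) + suc n          ≡⟨ regroup (Σ< n (λ k → k)) n ⟩
  (2 * Σ< n (λ k → k) + n) + (2 * n + 1)    ≡⟨ cong (_+ (2 * n + 1)) (Σ<-id n) ⟩
  n * n + (2 * n + 1)                       ≡⟨ square n ⟩
  suc n * suc n                             ∎
  where
  open ≡-Reasoning
  regroup : ∀ s n → 2 * (s + n) + suc n ≡ (2 * s + n) + (2 * n + 1)
  regroup = ℕ-Solver.solve-∀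
  square : ∀ n → n * n + (2 * n + 1) ≡ suc n * suc n
  square = ℕ-Solver.solve-∀

*≤⇔≤/ : ∀ q x u .{{_ : NonZero q}} → q * x ≤ u ⇔ x ≤ u / q
*≤⇔≤/ q x u = mk⇔ to from
  where
  to : q * x ≤ u → x ≤ u / q
  to qx≤u = subst (_≤ u / q) (m*n/n≡m x q) (/-monoˡ-≤ q (subst (_≤ u) (*-comm q x) qx≤u))
  from : x ≤ u / q → q * x ≤ u
  from x≤u/q = ≤-trans (*-monoʳ-≤ q x≤u/q) (subst (_≤ u) (*-comm (u / q) q) (m/n*n≤m u q))

≤-minus⇔ : ∀ x y u → + x ℤ.≤ + u - + y ⇔ x + y ≤ u
≤-minus⇔ x y u = mk⇔ to from
  where
  restore : ∀ a b → (a - b) ℤ.+ b ≡ a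
  restore = ℤ-Solver.solve-∀
  to : + x ℤ.≤ + u - + y → x + y ≤ u
  to h = ℤ.drop‿+≤+ (subst₂ ℤ._≤_ (sym (ℤ.pos-+ x y)) (restore (+ u) (+ y)) (ℤ.+-monoˡ-≤ (+ y) h))
  from : x + y ≤ u → + x ℤ.≤ + u - + y
  from h = subst (ℤ._≤ + u - + y) (trans (cong (_- + y) (ℤ.pos-+ x y)) (cancel (+ x) (+ y)))
             (ℤ.+-monoˡ-≤ (- + y) (+≤+ h))
    where
    cancel : ∀ a b → (a ℤ.+ b) - b ≡ a
    cancel = ℤ-Solver.solve-∀

digit-unique : ∀ {Q r} (t : ℤ) → r < Q →
               0ℤ ℤ.≤ + r ℤ.+ + Q ℤ.* t → + r ℤ.+ + Q ℤ.* t ℤ.< + Q → t ≡ 0ℤ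
digit-unique (+ zero)    r<Q _ _ = refl
digit-unique {Q} {r} (+ (suc n)) r<Q _ below = ⊥-elim (<-irrefl refl
  (≤-<-trans (≤-trans (m≤m*n Q (suc n)) (m≤n+m (Q * suc n) r))
               (ℤ.drop‿+<+ (subst (ℤ._< + Q) (cong (λ z → + r ℤ.+ z) (sym (ℤ.pos-* Q (suc n)))) below))))
digit-unique {Q} {r} -[1+ n ]    r<Q above _ = ⊥-elim (<-irrefl refl
  (<-≤-trans r<Q (≤-trans (m≤m*n Q (suc n))
    (ℤ.drop‿+≤+ (ℤ.0≤i-j⇒j≤i (subst (0ℤ ℤ.≤_) (cong (λ z → + r ℤ.+ z) negated) above))))))
  where
  negated : + Q ℤ.* -[1+ n ] ≡ - + (Q * suc n)
  negated = trans (sym (ℤ.neg-distribʳ-* (+ Q) (+ (suc n)))) (cong -_ (sym (ℤ.pos-* Q (suc n))))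

lex-≤ : ∀ q t k s c → c < q → k ≤ c → (q * t + k ≤ q * s + c ⇔ t ≤ s)
lex-≤ q t k s c c<q k≤c = mk⇔ to (λ t≤s → +-mono-≤ (*-monoʳ-≤ q t≤s) k≤c)
  where
  to : q * t + k ≤ q * s + c → t ≤ s
  to h with t ≤? s
  ... | yes t≤s = t≤s
  ... | no t≰s = ⊥-elim (<-irrefl refl (begin-strict
    q * s + c   <⟨ +-monoʳ-< (q * s) c<q ⟩
    q * s + q   ≡⟨ trans (+-comm (q * s) q) (sym (*-suc q s)) ⟩
    q * suc s   ≤⟨ *-monoʳ-≤ q (≰⇒> t≰s) ⟩
    q * t       ≤⟨ m≤m+n (q * t) k ⟩
    q * t + k   ≤⟨ h ⟩
    q * s + c   ∎))
    where open ≤-Reasoning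

lex-< : ∀ q t k s c → k < q → c < k → (q * t + k ≤ q * s + c ⇔ t < s)
lex-< q t k s c k<q c<k = mk⇔ to from
  where
  open ≤-Reasoning
  to : q * t + k ≤ q * s + c → t < s
  to h with t <? s
  ... | yes t<s = t<s
  ... | no t≮s = ⊥-elim (<-irrefl refl (begin-strict
    q * s + c   <⟨ +-monoʳ-< (q * s) c<k ⟩
    q * s + k   ≤⟨ +-monoˡ-≤ k (*-monoʳ-≤ q (≮⇒≥ t≮s)) ⟩
    q * t + k   ≤⟨ h ⟩
    q * s + c   ∎))
  from : t < s → q * t + k ≤ q * s + c
  from t<s = begin
    q * t + k   ≤⟨ <⇒≤ (+-monoʳ-< (q * t) k<q) ⟩
    q * t + q   ≡⟨ trans (+-comm (q * t) q) (sym (*-suc q t)) ⟩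
    q * suc t   ≤⟨ *-monoʳ-≤ q t<s ⟩
    q * s       ≤⟨ m≤m+n (q * s) c ⟩
    q * s + c   ∎

base-q : ∀ m q .{{_ : NonZero q}} → m ≡ q * (m / q) + m % q
base-q m q = trans (m≡m%n+[m/n]*n m q) (trans (+-comm (m % q) _) (cong (_+ m % q) (*-comm (m / q) q)))

base-q-split : ∀ q m y k .{{_ : NonZero q}} →
               (q * y + suc q * k ≤ m) ≡ (q * (y + k) + k ≤ q * (m / q) + m % q)
base-q-split q m y k = cong₂ _≤_ (identity q y k) (base-q m q)
  where
  identity : ∀ q y k → q * y + (1 + q) * k ≡ q * (y + k) + k
  identity = ℕ-Solver.solve-∀

sum-window : ∀ M (f : ℤ → ℕ) → sum (map f (window M)) ≡ Σ< (suc (2 * M)) (λ n → f (+ n - + M))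
sum-window M f = trans (cong sum (sym (map-∘ (upTo (suc (2 * M))))))
                       (cong sum (map-upTo (λ n → f (+ n - + M)) (suc (2 * M))))

+[m+n]-m : ∀ m n → + (m + n) - + m ≡ + n
+[m+n]-m m n = trans (cong (_- + m) (ℤ.pos-+ m n)) (cancel (+ m) (+ n))
  where
  cancel : ∀ x y → (x ℤ.+ y) - x ≡ y
  cancel = ℤ-Solver.solve-∀

sum-window-nonneg : ∀ M (f : ℤ → ℕ) → (∀ x → x ℤ.< 0ℤ → f x ≡ 0) → f (+ M) ≡ 0 →
                    sum (map f (window M)) ≡ Σ< M (λ i → f (+ i))
sum-window-nonneg M f negative top = begin
  sum (map f (window M))
    ≡⟨ sum-window M f ⟩
  Σ< (suc (2 * M)) g
    ≡⟨ cong (λ n → Σ< n g) (range M) ⟩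
  Σ< (M + suc M) g
    ≡⟨ Σ<-split M (suc M) g ⟩
  Σ< M g + Σ< (suc M) (g ∘ (_+_ M))
    ≡⟨ cong₂ _+_ (Σ<-zero M (λ n n<M → negative _ (below n<M))) (Σ<-last M (g ∘ (_+_ M))) ⟩
  Σ< M (g ∘ (_+_ M)) + g (M + M)
    ≡⟨ cong (_+_ (Σ< M (g ∘ (_+_ M)))) (trans (cong f (+[m+n]-m M M)) top) ⟩
  Σ< M (g ∘ (_+_ M)) + 0
    ≡⟨ +-identityʳ _ ⟩
  Σ< M (g ∘ (_+_ M))
    ≡⟨ Σ<-cong M (λ i _ → cong f (+[m+n]-m M i)) ⟩
  Σ< M (λ i → f (+ i)) ∎
  where
  open ≡-Reasoning
  g : ℕ → ℕ
  g n = f (+ n - + M)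
  range : ∀ M → suc (2 * M) ≡ M + suc M
  range = ℕ-Solver.solve-∀
  below : ∀ {n} → n < M → + n - + M ℤ.< 0ℤ
  below {n} n<M = subst (+ n - + M ℤ.<_) (ℤ.+-inverseʳ (+ M)) (ℤ.+-monoˡ-< (- + M) (+<+ n<M))

sum-window-single : ∀ M k (f : ℤ → ℕ) → k ≤ M → (∀ x → x ≢ - + k → f x ≡ 0) →
                    sum (map f (window M)) ≡ f (- + k)
sum-window-single M k f k≤M elsewhere = begin
  sum (map f (window M))
    ≡⟨ sum-window M f ⟩
  Σ< (suc (2 * M)) (λ n → f (+ n - + M))
    ≡⟨ Σ<-single (suc (2 * M)) (M ∸ k) _ index<
         (λ n _ n≢ → elsewhere _ (n≢ ∘ injective)) ⟩
  f (+ (M ∸ k) - + M)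
    ≡⟨ cong f at-index ⟩
  f (- + k) ∎
  where
  open ≡-Reasoning
  index< : M ∸ k < suc (2 * M)
  index< = s≤s (≤-trans (m∸n≤m M k) (m≤m+n M (M + 0)))
  at-index : + (M ∸ k) - + M ≡ - + k
  at-index = begin
    + (M ∸ k) - + M                   ≡⟨ cong (λ n → + (M ∸ k) - + n) (m∸n+n≡m k≤M) ⟨
    + (M ∸ k) - + (M ∸ k + k)         ≡⟨ cong (λ x → + (M ∸ k) - x) (ℤ.pos-+ (M ∸ k) k) ⟩
    + (M ∸ k) - (+ (M ∸ k) ℤ.+ + k)   ≡⟨ cancel (+ (M ∸ k)) (+ k) ⟩
    - + k                             ∎
    where
    cancel : ∀ x y → x - (x ℤ.+ y) ≡ - y
    cancel = ℤ-Solver.solve-∀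
  injective : ∀ {n} → + n - + M ≡ - + k → n ≡ M ∸ k
  injective {n} eq = ℤ.+-injective (begin
    + n                         ≡⟨ restore (+ n) (+ M) ⟨
    (+ n - + M) ℤ.+ + M         ≡⟨ cong (ℤ._+ + M) (trans eq (sym at-index)) ⟩
    (+ (M ∸ k) - + M) ℤ.+ + M   ≡⟨ restore (+ (M ∸ k)) (+ M) ⟩
    + (M ∸ k)                   ∎)
    where
    restore : ∀ x y → (x - y) ℤ.+ y ≡ x
    restore = ℤ-Solver.solve-∀

module Membership (q a u : ℕ) .{{_ : NonZero q}} where

  Q : ℕ
  Q = suc q

  -- q > 0 as an integer, needed to cancel the factor q in the strip condition.
  instance
    +q-positive : ℤ.Positive (+ q)
    +q-positive = ℤ.positive (+<+ (>-nonZero⁻¹ q))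

  q²+q≡qQ : q ^ 2 + q ≡ q * Q
  q²+q≡qQ = identity q
    where
    identity : ∀ q → q * (q * 1) + q ≡ q * suc q
    identity = ℕ-Solver.solve-∀

  +[Qk+r] : ∀ k r → + (Q * k + r) ≡ + Q ℤ.* + k ℤ.+ + r
  +[Qk+r] k r = trans (ℤ.pos-+ (Q * k) r) (cong (ℤ._+ + r) (ℤ.pos-* Q k))

  strip-value : ∀ k r j → + q ℤ.* + (Q * k + r) ℤ.+ + (q ^ 2 + q) ℤ.* j
                          ≡ + q ℤ.* (+ r ℤ.+ + Q ℤ.* (+ k ℤ.+ j))
  strip-value k r j = begin
    + q ℤ.* + (Q * k + r) ℤ.+ + (q ^ 2 + q) ℤ.* j
      ≡⟨ cong₂ (λ x y → + q ℤ.* x ℤ.+ y ℤ.* j) (+[Qk+r] k r) (trans (cong +_ q²+q≡qQ) (ℤ.pos-* q Q)) ⟩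
    + q ℤ.* (+ Q ℤ.* + k ℤ.+ + r) ℤ.+ (+ q ℤ.* + Q) ℤ.* j
      ≡⟨ identity (+ q) (+ Q) (+ k) (+ r) j ⟩
    + q ℤ.* (+ r ℤ.+ + Q ℤ.* (+ k ℤ.+ j)) ∎
    where
    open ≡-Reasoning
    identity : ∀ q Q k r j → q ℤ.* (Q ℤ.* k ℤ.+ r) ℤ.+ (q ℤ.* Q) ℤ.* j ≡ q ℤ.* (r ℤ.+ Q ℤ.* (k ℤ.+ j))
    identity = ℤ-Solver.solve-∀

  strip-forces : ∀ k r j → r < Q →
    0ℤ ℤ.≤ + q ℤ.* + (Q * k + r) ℤ.+ + (q ^ 2 + q) ℤ.* j →
    + q ℤ.* + (Q * k + r) ℤ.+ + (q ^ 2 + q) ℤ.* j ℤ.< + (q ^ 2 + q) →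
    j ≡ - + k
  strip-forces k r j r<Q lower upper = begin
    j                   ≡⟨ isolate (+ k) j ⟩
    (+ k ℤ.+ j) - + k   ≡⟨ cong (_- + k) (digit-unique (+ k ℤ.+ j) r<Q digit-lower digit-upper) ⟩
    0ℤ - + k            ≡⟨ ℤ.+-identityˡ (- + k) ⟩
    - + k               ∎
    where
    open ≡-Reasoning
    isolate : ∀ k j → j ≡ (k ℤ.+ j) - k
    isolate = ℤ-Solver.solve-∀
    digit = + r ℤ.+ + Q ℤ.* (+ k ℤ.+ j)
    digit-lower : 0ℤ ℤ.≤ digit
    digit-lower = ℤ.*-cancelˡ-≤-pos 0ℤ digit (+ q)
      (subst₂ ℤ._≤_ (sym (ℤ.*-zeroʳ (+ q))) (strip-value k r j) lower)
    digit-upper : digit ℤ.< + Q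
    digit-upper = ℤ.*-cancelˡ-<-nonNeg (+ q)
      (subst₂ ℤ._<_ (strip-value k r j) (trans (cong +_ q²+q≡qQ) (ℤ.pos-* q Q)) upper)

  strip-at : ∀ k r → + q ℤ.* + (Q * k + r) ℤ.+ + (q ^ 2 + q) ℤ.* (- + k) ≡ + (q * r)
  strip-at k r = begin
    + q ℤ.* + (Q * k + r) ℤ.+ + (q ^ 2 + q) ℤ.* (- + k)
      ≡⟨ strip-value k r (- + k) ⟩
    + q ℤ.* (+ r ℤ.+ + Q ℤ.* (+ k - + k))
      ≡⟨ identity (+ q) (+ Q) (+ k) (+ r) ⟩
    + q ℤ.* + r
      ≡⟨ ℤ.pos-* q r ⟨
    + (q * r) ∎
    where
    open ≡-Reasoning
    identity : ∀ q Q k r → q ℤ.* (r ℤ.+ Q ℤ.* (k - k)) ≡ q ℤ.* r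
    identity = ℤ-Solver.solve-∀

  height-at : ∀ k r → + (q ^ 2) ℤ.* + (Q * k + r) ℤ.+ (+ (q ^ 3) - + q) ℤ.* (- + k)
                      ≡ + (q * (q * r + Q * k))
  height-at k r = begin
    + (q ^ 2) ℤ.* + (Q * k + r) ℤ.+ (+ (q ^ 3) - + q) ℤ.* (- + k)
      ≡⟨ cong₂ (λ x y → x ℤ.* + (Q * k + r) ℤ.+ (y - + q) ℤ.* (- + k)) +q² +q³ ⟩
    (+ q ℤ.* + q) ℤ.* + (Q * k + r) ℤ.+ (+ q ℤ.* (+ q ℤ.* + q) - + q) ℤ.* (- + k)
      ≡⟨ cong (λ x → (+ q ℤ.* + q) ℤ.* x ℤ.+ (+ q ℤ.* (+ q ℤ.* + q) - + q) ℤ.* (- + k)) (+[Qk+r] k r) ⟩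
    (+ q ℤ.* + q) ℤ.* (+ Q ℤ.* + k ℤ.+ + r) ℤ.+ (+ q ℤ.* (+ q ℤ.* + q) - + q) ℤ.* (- + k)
      ≡⟨ identity (+ q) (+ k) (+ r) ⟩
    + q ℤ.* (+ q ℤ.* + r ℤ.+ + Q ℤ.* + k)
      ≡⟨ cong (+ q ℤ.*_) (cong₂ ℤ._+_ (ℤ.pos-* q r) (ℤ.pos-* Q k)) ⟨
    + q ℤ.* + (q * r + Q * k)
      ≡⟨ ℤ.pos-* q (q * r + Q * k) ⟨
    + (q * (q * r + Q * k)) ∎
    where
    open ≡-Reasoning
    +q² : + (q ^ 2) ≡ + q ℤ.* + q
    +q² = trans (cong (λ n → + (q * n)) (*-identityʳ q)) (ℤ.pos-* q q)
    +q³ : + (q ^ 3) ≡ + q ℤ.* (+ q ℤ.* + q)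
    +q³ = trans (ℤ.pos-* q (q ^ 2)) (cong (+ q ℤ.*_) +q²)
    identity : ∀ q k r → (q ℤ.* q) ℤ.* ((1ℤ ℤ.+ q) ℤ.* k ℤ.+ r) ℤ.+ (q ℤ.* (q ℤ.* q) - q) ℤ.* (- k)
                         ≡ q ℤ.* (q ℤ.* r ℤ.+ (1ℤ ℤ.+ q) ℤ.* k)
    identity = ℤ-Solver.solve-∀

  InΨ⇒column : ∀ k r j → r < Q → InΨ q a u (+ (Q * k + r) , j) → j ≡ - + k
  InΨ⇒column k r j r<Q (_ , _ , lower , upper , _) = strip-forces k r j r<Q lower upper

  InΨ-column⇔ : ∀ k r → k < q → r < Q →
                InΨ q a u (+ (Q * k + r) , - + k) ⇔ q * (Q * a + r) + Q * k ≤ u / q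
  InΨ-column⇔ k r k<q r<Q = mk⇔ (Equivalence.to height⇔ ∘ proj₂ ∘ proj₂ ∘ proj₂ ∘ proj₂)
    (λ bound → +≤+ z≤n , +<+ i<M , lower , upper , Equivalence.from height⇔ bound)
    where
    i<M : Q * k + r < q ^ 2 + q
    i<M = begin-strict
      Q * k + r   <⟨ +-monoʳ-< (Q * k) r<Q ⟩
      Q * k + Q   ≡⟨ trans (+-comm (Q * k) Q) (sym (*-suc Q k)) ⟩
      Q * suc k   ≤⟨ *-monoʳ-≤ Q k<q ⟩
      Q * q       ≡⟨ *-comm Q q ⟩
      q * Q       ≡⟨ q²+q≡qQ ⟨
      q ^ 2 + q   ∎
      where open ≤-Reasoning
    lower = subst (0ℤ ℤ.≤_) (sym (strip-at k r)) (+≤+ z≤n)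
    upper = subst₂ ℤ._<_ (sym (strip-at k r)) (cong +_ (sym q²+q≡qQ)) (+<+ (*-monoʳ-< q r<Q))
    height⇔ : (+ (q ^ 2) ℤ.* + (Q * k + r) ℤ.+ (+ (q ^ 3) - + q) ℤ.* (- + k)
                 ℤ.≤ + u - + (q ^ 3 + q ^ 2) ℤ.* + a)
              ⇔ q * (Q * a + r) + Q * k ≤ u / q
    height⇔ = begin
      (+ (q ^ 2) ℤ.* + (Q * k + r) ℤ.+ (+ (q ^ 3) - + q) ℤ.* (- + k)
         ℤ.≤ + u - + (q ^ 3 + q ^ 2) ℤ.* + a)
        ≡⟨ cong₂ ℤ._≤_ (height-at k r) (cong (λ y → + u - y) (sym (ℤ.pos-* (q ^ 3 + q ^ 2) a))) ⟩
      (+ (q * (q * r + Q * k)) ℤ.≤ + u - + ((q ^ 3 + q ^ 2) * a))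
        ≈⟨ ≤-minus⇔ (q * (q * r + Q * k)) ((q ^ 3 + q ^ 2) * a) u ⟩
      (q * (q * r + Q * k) + (q ^ 3 + q ^ 2) * a ≤ u)
        ≡⟨ cong (_≤ u) (identity q k r a) ⟩
      (q * (q * (Q * a + r) + Q * k) ≤ u)
        ≈⟨ *≤⇔≤/ q (q * (Q * a + r) + Q * k) u ⟩
      (q * (Q * a + r) + Q * k ≤ u / q) ∎
      where
      open ⇔-Reasoning
      identity : ∀ q k r a →
        q * (q * r + (1 + q) * k) + (q * (q * (q * 1)) + q * (q * 1)) * a
        ≡ q * (q * ((1 + q) * a + r) + (1 + q) * k)
      identity = ℕ-Solver.solve-∀

#Ψ≡ : ∀ q a u .{{_ : NonZero q}} →
      #Ψ q a u ≡ Σ< q (λ k → Σ< (suc q) (λ r → 𝟙 (q * (suc q * a + r) + suc q * k ≤? u / q)))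
#Ψ≡ q a u = begin
  length (filter (InΨ? q a u) (cartesianProduct W W))
    ≡⟨ length-filter-𝟙 (InΨ? q a u) (cartesianProduct W W) ⟩
  sum (map (𝟙 ∘ InΨ? q a u) (cartesianProduct W W))
    ≡⟨ sum-cartesianProduct (𝟙 ∘ InΨ? q a u) W W ⟩
  sum (map row W)
    ≡⟨ sum-window-nonneg M row (λ x x<0 → row-zero x (λ (0≤x , _) → ℤ.<-irrefl refl (ℤ.<-≤-trans x<0 0≤x)))
                             (row-zero (+ M) (λ (_ , M<M , _) → ℤ.<-irrefl refl M<M)) ⟩
  Σ< M (row ∘ +_)
    ≡⟨ cong (λ n → Σ< n (row ∘ +_)) q²+q≡qQ ⟩
  Σ< (q * Q) (row ∘ +_)
    ≡⟨ Σ<-* q Q (row ∘ +_) ⟩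
  Σ< q (λ k → Σ< Q (λ r → row (+ (Q * k + r))))
    ≡⟨ Σ<-cong q (λ k k<q → Σ<-cong Q (λ r r<Q → trans (row-single k r k<q r<Q) (at-column k r k<q r<Q))) ⟩
  Σ< q (λ k → Σ< Q (λ r → 𝟙 (q * (Q * a + r) + Q * k ≤? u / q))) ∎
  where
  open ≡-Reasoning
  open Membership q a u
  M = q ^ 2 + q
  W = window M
  row : ℤ → ℕ
  row x = sum (map (λ y → 𝟙 (InΨ? q a u (x , y))) W)
  row-zero : ∀ x → (∀ {y} → ¬ InΨ q a u (x , y)) → row x ≡ 0
  row-zero x ∉ = sum-map-zero _ W (λ y → 𝟙-no ∉ (InΨ? q a u (x , y)))
  row-single : ∀ k r → k < q → r < Q → row (+ (Q * k + r)) ≡ 𝟙 (InΨ? q a u (+ (Q * k + r) , - + k))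
  row-single k r k<q r<Q = sum-window-single M k _ (≤-trans (<⇒≤ k<q) (m≤n+m q (q ^ 2)))
    (λ y y≢-k → 𝟙-no (y≢-k ∘ InΨ⇒column k r y r<Q) (InΨ? q a u (+ (Q * k + r) , y)))
  at-column : ∀ k r → k < q → r < Q →
              𝟙 (InΨ? q a u (+ (Q * k + r) , - + k)) ≡ 𝟙 (q * (Q * a + r) + Q * k ≤? u / q)
  at-column k r k<q r<Q = 𝟙-cong (InΨ-column⇔ k r k<q r<Q) _ _

column-≤ : ∀ q m y k .{{_ : NonZero q}} → k ≤ m % q → k ≤ m / q →
           q * y + suc q * k ≤ m ⇔ y < suc (m / q ∸ k)
column-≤ q m y k k≤c k≤s = begin
  (q * y + suc q * k ≤ m)                 ≡⟨ base-q-split q m y k ⟩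
  (q * (y + k) + k ≤ q * (m / q) + m % q) ≈⟨ lex-≤ q (y + k) k (m / q) (m % q) (m%n<n m q) k≤c ⟩
  (y + k ≤ m / q)                         ≈⟨ mk⇔ (m+n≤o⇒m≤o∸n y) (m≤o∸n⇒m+n≤o y k≤s) ⟩
  (y ≤ m / q ∸ k)                         ≈⟨ mk⇔ s≤s s≤s⁻¹ ⟩
  (y < suc (m / q ∸ k))                   ∎
  where open ⇔-Reasoning

column-> : ∀ q m y k .{{_ : NonZero q}} → k < q → m % q < k → k ≤ m / q →
           q * y + suc q * k ≤ m ⇔ y < m / q ∸ k
column-> q m y k k<q c<k k≤s = begin
  (q * y + suc q * k ≤ m)                 ≡⟨ base-q-split q m y k ⟩
  (q * (y + k) + k ≤ q * (m / q) + m % q) ≈⟨ lex-< q (y + k) k (m / q) (m % q) k<q c<k ⟩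
  (suc y + k ≤ m / q)                     ≈⟨ mk⇔ (m+n≤o⇒m≤o∸n (suc y)) (m≤o∸n⇒m+n≤o (suc y) k≤s) ⟩
  (y < m / q ∸ k)                         ∎
  where open ⇔-Reasoning

column-count : ∀ q m L k .{{_ : NonZero q}} → k < q → k ≤ m / q → m / q < L →
  Σ< L (λ y → 𝟙 (q * y + suc q * k ≤? m)) ≡ m / q ∸ k + 𝟙 (k ≤? m % q)
column-count q m L k k<q k≤s s<L with k ≤? m % q
... | yes k≤c = begin
  Σ< L (λ y → 𝟙 (q * y + suc q * k ≤? m))   ≡⟨ Σ<-cong L (λ y _ → 𝟙-cong (column-≤ q m y k k≤c k≤s) _ _) ⟩
  Σ< L (λ y → 𝟙 (y <? suc (m / q ∸ k)))      ≡⟨ Σ<-below L _ (≤-<-trans (m∸n≤m (m / q) k) s<L) ⟩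
  suc (m / q ∸ k)                            ≡⟨ +-comm 1 (m / q ∸ k) ⟩
  m / q ∸ k + 1                              ∎
  where open ≡-Reasoning
... | no k≰c = begin
  Σ< L (λ y → 𝟙 (q * y + suc q * k ≤? m))   ≡⟨ Σ<-cong L (λ y _ → 𝟙-cong (column-> q m y k k<q (≰⇒> k≰c) k≤s) _ _) ⟩
  Σ< L (λ y → 𝟙 (y <? m / q ∸ k))            ≡⟨ Σ<-below L _ (≤-trans (m∸n≤m (m / q) k) (<⇒≤ s<L)) ⟩
  m / q ∸ k                                  ≡⟨ +-identityʳ (m / q ∸ k) ⟨
  m / q ∸ k + 0                              ∎
  where open ≡-Reasoning

columns-total : ∀ q m L .{{_ : NonZero q}} → q ≤ m / q → m / q < L →
  2 * Σ< q (λ k → Σ< L (λ y → 𝟙 (q * y + suc q * k ≤? m))) + q * q ≡ 2 + q + 2 * m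
columns-total q m L q≤s s<L = begin
  2 * Σ< q (λ k → Σ< L (λ y → 𝟙 (q * y + suc q * k ≤? m))) + q * q
    ≡⟨ cong (λ x → 2 * x + q * q) (Σ<-cong q (λ k k<q → column-count q m L k k<q (k≤s k<q) s<L)) ⟩
  2 * Σ< q (λ k → s ∸ k + 𝟙 (k ≤? c)) + q * q
    ≡⟨ cong (λ x → 2 * x + q * q) (Σ<-+ q (s ∸_) (λ k → 𝟙 (k ≤? c))) ⟩
  2 * (A + Σ< q (λ k → 𝟙 (k ≤? c))) + q * q
    ≡⟨ cong₂ (λ x y → 2 * (A + x) + y) digits-below-c (sym (Σ<-id q)) ⟩
  2 * (A + suc c) + (2 * B + q)
    ≡⟨ regroup A B c q ⟩
  2 * (A + B) + (2 + q + 2 * c)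
    ≡⟨ cong (λ x → 2 * x + (2 + q + 2 * c)) A+B≡qs ⟩
  2 * (q * s) + (2 + q + 2 * c)
    ≡⟨ collect q s c ⟩
  2 + q + 2 * (q * s + c)
    ≡⟨ cong (λ x → 2 + q + 2 * x) (base-q m q) ⟨
  2 + q + 2 * m ∎
  where
  open ≡-Reasoning
  s = m / q
  c = m % q
  A = Σ< q (s ∸_)
  B = Σ< q (λ k → k)
  k≤s : ∀ {k} → k < q → k ≤ s
  k≤s k<q = ≤-trans (<⇒≤ k<q) q≤s
  digits-below-c : Σ< q (λ k → 𝟙 (k ≤? c)) ≡ suc c
  digits-below-c = trans (Σ<-cong q (λ k _ → 𝟙-cong (mk⇔ s≤s s≤s⁻¹) (k ≤? c) (k <? suc c)))
                         (Σ<-below q (suc c) (m%n<n m q))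
  A+B≡qs : A + B ≡ q * s
  A+B≡qs = begin
    A + B                         ≡⟨ Σ<-+ q (s ∸_) (λ k → k) ⟨
    Σ< q (λ k → s ∸ k + k)        ≡⟨ Σ<-cong q (λ k k<q → m∸n+n≡m (k≤s k<q)) ⟩
    Σ< q (λ _ → s)                ≡⟨ Σ<-const q s ⟩
    q * s                         ∎
  regroup : ∀ A B c q → 2 * (A + suc c) + (2 * B + q) ≡ 2 * (A + B) + (2 + q + 2 * c)
  regroup = ℕ-Solver.solve-∀
  collect : ∀ q s c → 2 * (q * s) + (2 + q + 2 * c) ≡ 2 + q + 2 * (q * s + c)
  collect = ℕ-Solver.solve-∀

ΣΨ≡columns : ∀ q u N .{{_ : NonZero q}} →
  ΣΨ q u N ≡ Σ< q (λ k → Σ< (suc N * suc q) (λ y → 𝟙 (q * y + suc q * k ≤? u / q)))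
ΣΨ≡columns q u N = begin
  sum (map (λ a → #Ψ q a u) (upTo (suc N)))
    ≡⟨ cong sum (map-upTo (λ a → #Ψ q a u) (suc N)) ⟩
  Σ< (suc N) (λ a → #Ψ q a u)
    ≡⟨ Σ<-cong (suc N) (λ a _ → #Ψ≡ q a u) ⟩
  Σ< (suc N) (λ a → Σ< q (λ k → Σ< (suc q) (λ r → 𝟙 (q * (suc q * a + r) + suc q * k ≤? u / q))))
    ≡⟨ Σ<-swap (suc N) q (λ a k → Σ< (suc q) (λ r → 𝟙 (q * (suc q * a + r) + suc q * k ≤? u / q))) ⟩
  Σ< q (λ k → Σ< (suc N) (λ a → Σ< (suc q) (λ r → 𝟙 (q * (suc q * a + r) + suc q * k ≤? u / q))))
    ≡⟨ Σ<-cong q (λ k _ → Σ<-* (suc N) (suc q) (λ y → 𝟙 (q * y + suc q * k ≤? u / q))) ⟨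
  Σ< q (λ k → Σ< (suc N * suc q) (λ y → 𝟙 (q * y + suc q * k ≤? u / q))) ∎
  where open ≡-Reasoning

ΣΨ-formula : ∀ q u N .{{_ : NonZero q}} → q ^ 3 + q ^ 2 ≤ u → u ≤ N →
             2 * ΣΨ q u N + q * q ≡ 2 + q + 2 * (u / q)
ΣΨ-formula q u N u≥u* u≤N =
  trans (cong (λ x → 2 * x + q * q) (ΣΨ≡columns q u N)) (columns-total q (u / q) (suc N * suc q) q≤s s<L)
  where
  m = u / q
  q*[q*q+q]≤u : q * (q * q + q) ≤ u
  q*[q*q+q]≤u = subst (_≤ u) (identity q) u≥u*
    where
    identity : ∀ q → q * (q * (q * 1)) + q * (q * 1) ≡ q * (q * q + q)
    identity = ℕ-Solver.solve-∀
  q≤s : q ≤ m / q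
  q≤s = Equivalence.to (*≤⇔≤/ q q m)
          (≤-trans (m≤m+n (q * q) q) (Equivalence.to (*≤⇔≤/ q (q * q + q) u) q*[q*q+q]≤u))
  s<L : m / q < suc N * suc q
  s<L = ≤-trans (s≤s (≤-trans (m/n≤m m q) (≤-trans (m/n≤m u q) u≤N))) (m≤m*n (suc N) (suc q))

lemma2p10 : (q : ℕ) → .{{_ : NonZero q}} → IsPrimePower q →
    (u : ℕ) → u ≥ q ^ 3 ℕ.+ q ^ 2 →
    (N : ℕ) → N ≥ u →
    (+ 2) ℤ.* (+ ΣΨ q u N) ≡ ((+ 2) ℤ.+ (+ q) - (+ (q ^ 2))) ℤ.+ (+ 2) ℤ.* (+ (u / q))
lemma2p10 q _ u u≥u* N N≥u = begin
  + 2 ℤ.* + ΣΨ q u N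
    ≡⟨ cancel (+ 2 ℤ.* + ΣΨ q u N) (+ (q ^ 2)) ⟨
  (+ 2 ℤ.* + ΣΨ q u N ℤ.+ + (q ^ 2)) - + (q ^ 2)
    ≡⟨ cong₂ (λ x y → (x ℤ.+ y) - + (q ^ 2)) (sym (ℤ.pos-* 2 (ΣΨ q u N))) (sym q*q≡q²) ⟩
  + (2 * ΣΨ q u N + q * q) - + (q ^ 2)
    ≡⟨ cong (λ n → + n - + (q ^ 2)) (ΣΨ-formula q u N u≥u* N≥u) ⟩
  + (2 + q + 2 * (u / q)) - + (q ^ 2)
    ≡⟨ cong (λ x → + (2 + q) ℤ.+ x - + (q ^ 2)) (ℤ.pos-* 2 (u / q)) ⟩
  (+ 2 ℤ.+ + q ℤ.+ + 2 ℤ.* + (u / q)) - + (q ^ 2)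
    ≡⟨ rearrange (+ q) (+ (u / q)) (+ (q ^ 2)) ⟩
  (+ 2 ℤ.+ + q - + (q ^ 2)) ℤ.+ + 2 ℤ.* + (u / q) ∎
  where
  open ≡-Reasoning
  q*q≡q² : + (q * q) ≡ + (q ^ 2)
  q*q≡q² = cong (λ n → + (q * n)) (sym (*-identityʳ q))
  cancel : ∀ x y → (x ℤ.+ y) - y ≡ x
  cancel = ℤ-Solver.solve-∀
  rearrange : ∀ q m q² → (+ 2 ℤ.+ q ℤ.+ + 2 ℤ.* m) - q² ≡ (+ 2 ℤ.+ q - q²) ℤ.+ + 2 ℤ.* m
  rearrange = ℤ-Solver.solve-∀
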